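{- Let $\mathcal{D}$ be the set of all Dyck paths, and for $D\in\mathcal{D}$ let $|D|$ be its semilength and $\mathrm{sp}'(D)$ the number of pairs of consecutive valleys of $D$ that are at the same height. Then, as formal power series, $$\sum_{D\in\mathcal{D}} t^{\mathrm{sp}'(D)}z^{|D|}=\frac{1+z-tz-\sqrt{(1+z-tz)^2-4z(1-tz)/(1-z)}}{2z}.$$
   Context: A Dyck path of semilength $n$ is a lattice path with steps $\mathbf{u}=(1,1)$ and $\mathbf{d}=(1,-1)$ from $(0,0)$ to $(2n,0)$ never going below the $x$-axis. A valley is an occurrence of two consecutive steps $\mathbf{du}$; its height is the $y$-coordinate of its lowest vertex. Two valleys are consecutive if there is no other valley between them (reading the path from left to right). -}

module Defs where

open import Data.Nat as ℕ using (ℕ; zero; suc; _∸_; _≡ᵇ_)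
open import Data.Bool using (Bool; true; false; if_then_else_; _∧_)
open import Data.List using (List; []; _∷_; length; filter; concatMap; map)
open import Data.Integer as ℤ using (ℤ; +_)
open import Relation.Nullary.Decidable using (Dec; yes; no)
open import Data.Bool.Properties using (T?)
open import Relation.Binary.PropositionalEquality using (_≡_)

-- Steps of a lattice path: U = (1,1), D = (1,-1).
data Step : Set where
  U D : Step

words : ℕ → List (List Step)
words zero    = [] ∷ []
words (suc m) = concatMap (λ w → (U ∷ w) ∷ (D ∷ w) ∷ []) (words m)

dyckFrom : ℕ → List Step → Bool
dyckFrom zero    []       = true
dyckFrom (suc _) []       = false
dyckFrom h       (U ∷ s)  = dyckFrom (suc h) s
dyckFrom zero    (D ∷ s)  = false
dyckFrom (suc h) (D ∷ s)  = dyckFrom h s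

isDyck : List Step → Bool
isDyck = dyckFrom 0

dyckPaths : ℕ → List (List Step)
dyckPaths n = filter (λ w → T? (isDyck w)) (words (n ℕ.+ n))

-- The height of a valley is the y-coordinate of its lowest
-- vertex, i.e. the height after the D step.
valleyHeightsFrom : ℕ → List Step → List ℕ
valleyHeightsFrom h []            = []
valleyHeightsFrom h (U ∷ s)       = valleyHeightsFrom (suc h) s
valleyHeightsFrom h (D ∷ [])      = []
valleyHeightsFrom h (D ∷ U ∷ s)   = (h ∸ 1) ∷ valleyHeightsFrom (h ∸ 1) (U ∷ s)
valleyHeightsFrom h (D ∷ D ∷ s)   = valleyHeightsFrom (h ∸ 1) (D ∷ s)

valleyHeights : List Step → List ℕ
valleyHeights = valleyHeightsFrom 0

equalAdjacent : List ℕ → ℕ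
equalAdjacent []            = 0
equalAdjacent (x ∷ [])      = 0
equalAdjacent (x ∷ y ∷ r)   = (if x ≡ᵇ y then 1 else 0) ℕ.+ equalAdjacent (y ∷ r)

sp′ : List Step → ℕ
sp′ w = equalAdjacent (valleyHeights w)

-- Formal power series in z and t with integer coefficients:
-- f n k is the coefficient of z^n t^k.

Series : Set
Series = ℕ → ℕ → ℤ

sumTo : ℕ → (ℕ → ℤ) → ℤ
sumTo zero    f = f 0
sumTo (suc n) f = sumTo n f ℤ.+ f (suc n)

infixl 6 _⊕_ _⊖_
infixl 7 _⊗_
infix 4 _≈ₛ_

_⊕_ : Series → Series → Series
(f ⊕ g) n k = f n k ℤ.+ g n k

_⊖_ : Series → Series → Series
(f ⊖ g) n k = f n k ℤ.- g n k

_⊗_ : Series → Series → Series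
(f ⊗ g) n k = sumTo n (λ i → sumTo k (λ j → f i j ℤ.* g (n ∸ i) (k ∸ j)))

const : ℤ → Series
const c zero zero = c
const c _    _    = + 0

𝟙 : Series
𝟙 = const (+ 1)

Z : Series
Z (suc zero) zero = + 1
Z _          _    = + 0

T : Series
T zero (suc zero) = + 1
T _    _          = + 0

-- 1/(1-z) = Σ z^n
geom : Series
geom n zero    = + 1
geom n (suc _) = + 0

_≈ₛ_ : Series → Series → Set
f ≈ₛ g = ∀ n k → f n k ≡ g n k

dyckGF : Series
dyckGF n k = + length (filter (λ w → sp′ w ℕ.≟ k) (dyckPaths n))

bSeries : Series
bSeries = 𝟙 ⊕ Z ⊖ T ⊗ Z

discr : Series
discr = bSeries ⊗ bSeries ⊖ const (+ 4) ⊗ Z ⊗ (𝟙 ⊖ T ⊗ Z) ⊗ geom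

module Submission where

-- Through the first-return decomposition P = U A D B, Dyck paths are binary trees.  The
-- valley between A and B is on the ground, so sp′ P = sp′ A + sp′ B + [the first valley
-- of B is on the ground], which happens exactly when B is nonempty and its first factor
-- is a pyramid Uᵏ Dᵏ.  Let G be the generating function, K the one of the paths whose
-- first valley is on the ground and L = G − K.  The decomposition gives
-- G = 1 + z G (L + t K), and, since pyramids contribute 1/(1 − z),
-- (1 − z) K = z (L + t K − 1).  Eliminating K and L leaves (1 − z)(bG − zG²) = 1 − tz
-- with b = 1 + z − tz, that is (b − 2zG)² = b² − 4z(1 − tz)/(1 − z).
-- Bivariate series are treated as power series over ℤ⟦t⟧, so that the ring laws,
-- and with them the ring solver, come from a single construction of power series rings.

open import Algebra.Bundles using (CommutativeSemiring; CommutativeRing)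
open import Algebra.Structures using (IsCommutativeRing)
open import Data.Product using (Σ; _×_; _,_; proj₁)
open import Data.Nat as ℕ using (ℕ; zero; suc; _∸_; _≡ᵇ_; z≤n; s≤s) renaming (_+_ to _+ℕ_; _≤_ to _≤ℕ_)
import Data.Nat.Properties as ℕP
open import Data.List using (List; []; _∷_; _++_; map; concatMap; cartesianProductWith; applyUpTo; upTo; length; null; filter)
import Data.List.Properties as LP
open import Data.List.Membership.Propositional using (_∈_; find)
open import Data.List.Membership.Propositional.Properties
  using ( ∈-concatMap⁺; ∈-concatMap⁻; ∈-cartesianProductWith⁺; ∈-cartesianProductWith⁻; ∈-upTo⁺; ∈-upTo⁻
        ; ∈-map⁺; ∈-map⁻; ∈-filter⁺; ∈-filter⁻)
open import Data.List.Membership.Propositional.Properties.WithK using (unique∧set⇒bag)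
open import Data.List.Relation.Binary.BagAndSetEquality using (∼bag⇒↭)
open import Data.List.Relation.Binary.Disjoint.Propositional using (Disjoint)
open import Data.List.Relation.Unary.Any as Any using (here; there)
open import Data.List.Relation.Unary.All as All using ([]; _∷_)
import Data.List.Relation.Unary.All.Properties as AllP
open import Data.List.Relation.Unary.AllPairs as AllPairs using ([]; _∷_)
import Data.List.Relation.Unary.AllPairs.Properties as AllPairsP
open import Data.List.Relation.Unary.Unique.Propositional using (Unique)
import Data.List.Relation.Unary.Unique.Propositional.Properties as UniqueP
open import Function.Bundles using (_⇔_; mk⇔; Equivalence)
open import Data.Vec using (Vec; []; _∷_)
open import Data.Bool using (Bool; true; false; _∧_; not; if_then_else_)
open import Data.Bool.Properties using (T?; T-≡; ∧-comm)
open import Data.Nat.Tactic.RingSolver using (solve-∀)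
open import Data.List.Relation.Binary.Permutation.Propositional as ↭ using (_↭_)
import Relation.Binary.PropositionalEquality as ≡
open ≡ using (_≡_; _≢_)
open import Relation.Nullary using (contradiction; yes; no)
open import Data.Maybe using (Maybe; just; nothing)
open import Data.Integer as ℤ using (ℤ; +_; 0ℤ; 1ℤ)
import Data.Integer.Properties as ℤP
open import Algebra.Solver.Ring.AlmostCommutativeRing
  using (_-Raw-AlmostCommutative⟶_; fromCommutativeRing)
import Relation.Binary.Reasoning.Setoid as SetoidReasoning

module FiniteSums {c ℓ} (R : CommutativeSemiring c ℓ) where

  open CommutativeSemiring R
  open import Algebra.Properties.CommutativeSemigroup +-commutativeSemigroup
    using (x∙yz≈y∙xz) renaming (interchange to +-interchange)
  open import Algebra.Properties.CommutativeSemigroup *-commutativeSemigroup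
    using () renaming (interchange to *-interchange)
  open import Relation.Binary.Reasoning.Setoid setoid

  ∑ : ℕ → (ℕ → Carrier) → Carrier
  ∑ zero    f = f 0
  ∑ (suc n) f = ∑ n f + f (suc n)

  ∑-cong-≤ : ∀ n {f g} → (∀ {i} → i ≤ℕ n → f i ≈ g i) → ∑ n f ≈ ∑ n g
  ∑-cong-≤ zero    f≈g = f≈g z≤n
  ∑-cong-≤ (suc n) f≈g = +-cong (∑-cong-≤ n (λ i≤n → f≈g (ℕP.m≤n⇒m≤1+n i≤n))) (f≈g ℕP.≤-refl)

  ∑-cong : ∀ n {f g} → (∀ i → f i ≈ g i) → ∑ n f ≈ ∑ n g
  ∑-cong n f≈g = ∑-cong-≤ n (λ {i} _ → f≈g i)

  ∑-+ : ∀ n f g → ∑ n (λ i → f i + g i) ≈ ∑ n f + ∑ n g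
  ∑-+ zero    f g = refl
  ∑-+ (suc n) f g = trans (+-congʳ (∑-+ n f g)) (+-interchange _ _ _ _)

  ∑-*ˡ : ∀ n a f → a * ∑ n f ≈ ∑ n (λ i → a * f i)
  ∑-*ˡ zero    a f = refl
  ∑-*ˡ (suc n) a f = trans (distribˡ a _ _) (+-congʳ (∑-*ˡ n a f))

  ∑-*ʳ : ∀ n a f → ∑ n f * a ≈ ∑ n (λ i → f i * a)
  ∑-*ʳ zero    a f = refl
  ∑-*ʳ (suc n) a f = trans (distribʳ a _ _) (+-congʳ (∑-*ʳ n a f))

  ∑-zero : ∀ n f → (∀ i → f i ≈ 0#) → ∑ n f ≈ 0#
  ∑-zero zero    f f≈0 = f≈0 0
  ∑-zero (suc n) f f≈0 = trans (+-cong (∑-zero n f f≈0) (f≈0 (suc n))) (+-identityˡ 0#)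

  ∑-suc : ∀ n f → ∑ (suc n) f ≈ f 0 + ∑ n (λ i → f (suc i))
  ∑-suc zero    f = refl
  ∑-suc (suc n) f = trans (+-congʳ (∑-suc n f)) (+-assoc _ _ _)

  ∑-reverse : ∀ n f → ∑ n f ≈ ∑ n (λ i → f (n ∸ i))
  ∑-reverse zero    f = refl
  ∑-reverse (suc n) f = begin
    ∑ n f + f (suc n)                  ≈⟨ +-congʳ (∑-reverse n f) ⟩
    ∑ n (λ i → f (n ∸ i)) + f (suc n)  ≈⟨ +-comm _ _ ⟩
    f (suc n) + ∑ n (λ i → f (n ∸ i))  ≈⟨ ∑-suc n (λ i → f (suc n ∸ i)) ⟨
    ∑ (suc n) (λ i → f (suc n ∸ i))    ∎

  -- the sum over 0 ≤ i ≤ m ≤ n, taken by columns and by rows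
  ∑-triangle : ∀ n (F : ℕ → ℕ → Carrier) →
               ∑ n (λ m → ∑ m (λ i → F i m)) ≈ ∑ n (λ i → ∑ (n ∸ i) (λ j → F i (i +ℕ j)))
  ∑-triangle zero    F = refl
  ∑-triangle (suc n) F = begin
    ∑ n (λ m → ∑ m (λ i → F i m)) + ∑ (suc n) (λ i → F i (suc n))
      ≈⟨ +-congʳ (∑-triangle n F) ⟩
    ∑ n row + (∑ n (λ i → F i (suc n)) + F (suc n) (suc n))
      ≈⟨ +-assoc _ _ _ ⟨
    (∑ n row + ∑ n (λ i → F i (suc n))) + F (suc n) (suc n)
      ≈⟨ +-congʳ (∑-+ n row (λ i → F i (suc n))) ⟨
    ∑ n (λ i → row i + F i (suc n)) + F (suc n) (suc n)
      ≈⟨ +-cong (∑-cong-≤ n extend-row) last-row ⟩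
    ∑ n (λ i → ∑ (suc n ∸ i) (λ j → F i (i +ℕ j))) + ∑ (n ∸ n) (λ j → F (suc n) (suc n +ℕ j)) ∎
    where
    row : ℕ → Carrier
    row i = ∑ (n ∸ i) (λ j → F i (i +ℕ j))
    extend-row : ∀ {i} → i ≤ℕ n → row i + F i (suc n) ≈ ∑ (suc n ∸ i) (λ j → F i (i +ℕ j))
    extend-row {i} i≤n = begin
      row i + F i (suc n)                 ≈⟨ +-congˡ (reflexive (≡.cong (F i) i+[1+n∸i]≡1+n)) ⟨
      ∑ (suc (n ∸ i)) (λ j → F i (i +ℕ j)) ≈⟨ reflexive (≡.cong (λ m → ∑ m (λ j → F i (i +ℕ j))) (ℕP.+-∸-assoc 1 i≤n)) ⟨
      ∑ (suc n ∸ i) (λ j → F i (i +ℕ j))  ∎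
      where
      i+[1+n∸i]≡1+n : i +ℕ suc (n ∸ i) ≡ suc n
      i+[1+n∸i]≡1+n = ≡.trans (ℕP.+-suc i (n ∸ i)) (≡.cong suc (ℕP.m+[n∸m]≡n i≤n))
    last-row : F (suc n) (suc n) ≈ ∑ (n ∸ n) (λ j → F (suc n) (suc n +ℕ j))
    last-row rewrite ℕP.n∸n≡0 n | ℕP.+-identityʳ n = refl

  δ : ℕ → ℕ → Carrier
  δ zero    zero    = 1#
  δ zero    (suc _) = 0#
  δ (suc _) zero    = 0#
  δ (suc x) (suc y) = δ x y

  δ-diagonal : ∀ x → δ x x ≈ 1#
  δ-diagonal zero    = refl
  δ-diagonal (suc x) = δ-diagonal x

  δ-off-diagonal : ∀ {x y} → x ≢ y → δ x y ≈ 0#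
  δ-off-diagonal {zero}  {zero}  x≢y = contradiction ≡.refl x≢y
  δ-off-diagonal {zero}  {suc y} _   = refl
  δ-off-diagonal {suc x} {zero}  _   = refl
  δ-off-diagonal {suc x} {suc y} x≢y = δ-off-diagonal (λ x≡y → x≢y (≡.cong suc x≡y))

  ∑-δ₀ : ∀ k (f : ℕ → Carrier) → ∑ k (λ c → δ 0 c * f c) ≈ f 0
  ∑-δ₀ zero    f = *-identityˡ (f 0)
  ∑-δ₀ (suc k) f = begin
    ∑ k (λ c → δ 0 c * f c) + 0# * f (suc k) ≈⟨ +-cong (∑-δ₀ k f) (zeroˡ _) ⟩
    f 0 + 0#                                 ≈⟨ +-identityʳ _ ⟩
    f 0                                      ∎

  δ-+ : ∀ x y k → δ (x +ℕ y) k ≈ ∑ k (λ c → δ x c * δ y (k ∸ c))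
  δ-+ zero    y k       = sym (∑-δ₀ k (λ c → δ y (k ∸ c)))
  δ-+ (suc x) y zero    = sym (zeroˡ _)
  δ-+ (suc x) y (suc k) = begin
    δ (x +ℕ y) k                                                ≈⟨ δ-+ x y k ⟩
    ∑ k (λ c → δ x c * δ y (k ∸ c))                             ≈⟨ +-identityˡ _ ⟨
    0# + ∑ k (λ c → δ x c * δ y (k ∸ c))                        ≈⟨ +-congʳ (zeroˡ _) ⟨
    δ (suc x) 0 * δ y (suc k) + ∑ k (λ c → δ x c * δ y (k ∸ c)) ≈⟨ ∑-suc k _ ⟨
    ∑ (suc k) (λ c → δ (suc x) c * δ y (suc k ∸ c))             ∎

  ∑ₗ : ∀ {a} {A : Set a} → List A → (A → Carrier) → Carrier
  ∑ₗ []       f = 0#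
  ∑ₗ (x ∷ xs) f = f x + ∑ₗ xs f

  module _ {a} {A : Set a} where

    ∑ₗ-cong : ∀ (xs : List A) {f g} → (∀ x → f x ≈ g x) → ∑ₗ xs f ≈ ∑ₗ xs g
    ∑ₗ-cong []       f≈g = refl
    ∑ₗ-cong (x ∷ xs) f≈g = +-cong (f≈g x) (∑ₗ-cong xs f≈g)

    ∑ₗ-zero : ∀ (xs : List A) f → (∀ x → f x ≈ 0#) → ∑ₗ xs f ≈ 0#
    ∑ₗ-zero []       f f≈0 = refl
    ∑ₗ-zero (x ∷ xs) f f≈0 = trans (+-cong (f≈0 x) (∑ₗ-zero xs f f≈0)) (+-identityˡ 0#)

    ∑ₗ-++ : ∀ (xs ys : List A) f → ∑ₗ (xs ++ ys) f ≈ ∑ₗ xs f + ∑ₗ ys f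
    ∑ₗ-++ []       ys f = sym (+-identityˡ _)
    ∑ₗ-++ (x ∷ xs) ys f = trans (+-congˡ (∑ₗ-++ xs ys f)) (sym (+-assoc _ _ _))

    ∑ₗ-+ : ∀ (xs : List A) f g → ∑ₗ xs (λ x → f x + g x) ≈ ∑ₗ xs f + ∑ₗ xs g
    ∑ₗ-+ []       f g = sym (+-identityˡ 0#)
    ∑ₗ-+ (x ∷ xs) f g = trans (+-congˡ (∑ₗ-+ xs f g)) (+-interchange _ _ _ _)

    ∑ₗ-*ˡ : ∀ (xs : List A) a f → a * ∑ₗ xs f ≈ ∑ₗ xs (λ x → a * f x)
    ∑ₗ-*ˡ []       a f = zeroʳ a
    ∑ₗ-*ˡ (x ∷ xs) a f = trans (distribˡ a _ _) (+-congˡ (∑ₗ-*ˡ xs a f))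

    ∑ₗ-*ʳ : ∀ (xs : List A) a f → ∑ₗ xs f * a ≈ ∑ₗ xs (λ x → f x * a)
    ∑ₗ-*ʳ []       a f = zeroˡ a
    ∑ₗ-*ʳ (x ∷ xs) a f = trans (distribʳ a _ _) (+-congˡ (∑ₗ-*ʳ xs a f))

    ∑ₗ-↭ : ∀ {xs ys : List A} f → xs ↭ ys → ∑ₗ xs f ≈ ∑ₗ ys f
    ∑ₗ-↭ f ↭.refl         = refl
    ∑ₗ-↭ f (↭.prep x p)   = +-congˡ (∑ₗ-↭ f p)
    ∑ₗ-↭ f (↭.swap x y p) = trans (+-congˡ (+-congˡ (∑ₗ-↭ f p))) (x∙yz≈y∙xz _ _ _)
    ∑ₗ-↭ f (↭.trans p q)  = trans (∑ₗ-↭ f p) (∑ₗ-↭ f q)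

    ∑ₗ-∑ : ∀ (xs : List A) k (F : A → ℕ → Carrier) → ∑ₗ xs (λ x → ∑ k (F x)) ≈ ∑ k (λ c → ∑ₗ xs (λ x → F x c))
    ∑ₗ-∑ []       k F = sym (∑-zero k _ (λ _ → refl))
    ∑ₗ-∑ (x ∷ xs) k F = trans (+-congˡ (∑ₗ-∑ xs k F)) (sym (∑-+ k (F x) _))

    ∑ₗ-applyUpTo : ∀ (g : ℕ → A) n f → ∑ₗ (applyUpTo g (suc n)) f ≈ ∑ n (λ i → f (g i))
    ∑ₗ-applyUpTo g zero    f = +-identityʳ _
    ∑ₗ-applyUpTo g (suc n) f = trans (+-congˡ (∑ₗ-applyUpTo (λ i → g (suc i)) n f)) (sym (∑-suc n _))

  module _ {a b} {A : Set a} {B : Set b} where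

    ∑ₗ-map : ∀ (g : A → B) xs f → ∑ₗ (map g xs) f ≈ ∑ₗ xs (λ x → f (g x))
    ∑ₗ-map g []       f = refl
    ∑ₗ-map g (x ∷ xs) f = +-congˡ (∑ₗ-map g xs f)

    ∑ₗ-concatMap : ∀ (g : A → List B) xs f → ∑ₗ (concatMap g xs) f ≈ ∑ₗ xs (λ x → ∑ₗ (g x) f)
    ∑ₗ-concatMap g []       f = refl
    ∑ₗ-concatMap g (x ∷ xs) f = trans (∑ₗ-++ (g x) _ f) (+-congˡ (∑ₗ-concatMap g xs f))

    ∑ₗ-δ-convolution : ∀ (xs : List A) (ys : List B) (p : A → Carrier) (α : A → ℕ) (q : B → Carrier) (β : B → ℕ) k →
      ∑ₗ xs (λ x → ∑ₗ ys (λ y → (p x * q y) * δ (α x +ℕ β y) k))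
      ≈ ∑ k (λ c → ∑ₗ xs (λ x → p x * δ (α x) c) * ∑ₗ ys (λ y → q y * δ (β y) (k ∸ c)))
    ∑ₗ-δ-convolution xs ys p α q β k = begin
      ∑ₗ xs (λ x → ∑ₗ ys (λ y → (p x * q y) * δ (α x +ℕ β y) k))
        ≈⟨ ∑ₗ-cong xs (λ x → ∑ₗ-cong ys (λ y → split x y)) ⟩
      ∑ₗ xs (λ x → ∑ₗ ys (λ y → ∑ k (λ c → term x y c)))
        ≈⟨ ∑ₗ-cong xs (λ x → ∑ₗ-∑ ys k (term x)) ⟩
      ∑ₗ xs (λ x → ∑ k (λ c → ∑ₗ ys (λ y → term x y c)))
        ≈⟨ ∑ₗ-∑ xs k (λ x c → ∑ₗ ys (λ y → term x y c)) ⟩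
      ∑ k (λ c → ∑ₗ xs (λ x → ∑ₗ ys (λ y → term x y c)))
        ≈⟨ ∑-cong k (λ c → trans (∑ₗ-cong xs (λ x → sym (∑ₗ-*ˡ ys _ _))) (sym (∑ₗ-*ʳ xs _ _))) ⟩
      ∑ k (λ c → ∑ₗ xs (λ x → p x * δ (α x) c) * ∑ₗ ys (λ y → q y * δ (β y) (k ∸ c))) ∎
      where
      term : A → B → ℕ → Carrier
      term x y c = (p x * δ (α x) c) * (q y * δ (β y) (k ∸ c))
      split : ∀ x y → (p x * q y) * δ (α x +ℕ β y) k ≈ ∑ k (term x y)
      split x y = begin
        (p x * q y) * δ (α x +ℕ β y) k                           ≈⟨ *-congˡ (δ-+ (α x) (β y) k) ⟩
        (p x * q y) * ∑ k (λ c → δ (α x) c * δ (β y) (k ∸ c))    ≈⟨ ∑-*ˡ k _ _ ⟩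
        ∑ k (λ c → (p x * q y) * (δ (α x) c * δ (β y) (k ∸ c)))  ≈⟨ ∑-cong k (λ c → *-interchange _ _ _ _) ⟩
        ∑ k (term x y)                                           ∎

  module _ {a b d} {A : Set a} {B : Set b} {C : Set d} where

    ∑ₗ-cartesianProductWith : ∀ (g : A → B → C) xs ys f →
      ∑ₗ (cartesianProductWith g xs ys) f ≈ ∑ₗ xs (λ x → ∑ₗ ys (λ y → f (g x y)))
    ∑ₗ-cartesianProductWith g []       ys f = refl
    ∑ₗ-cartesianProductWith g (x ∷ xs) ys f =
      trans (∑ₗ-++ (map (g x) ys) _ f) (+-cong (∑ₗ-map (g x) ys f) (∑ₗ-cartesianProductWith g xs ys f))

module PowerSeries {c ℓ} (R : CommutativeRing c ℓ) where

  open CommutativeRing R hiding (isCommutativeRing)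
  open FiniteSums commutativeSemiring
  open import Relation.Binary.Reasoning.Setoid setoid

  Series : Set c
  Series = ℕ → Carrier

  infix  4 _≈ˢ_
  infixl 6 _+ˢ_
  infixl 7 _*ˢ_

  _≈ˢ_ : Series → Series → Set ℓ
  f ≈ˢ g = ∀ n → f n ≈ g n

  _+ˢ_ : Series → Series → Series
  (f +ˢ g) n = f n + g n

  -ˢ_ : Series → Series
  (-ˢ f) n = - f n

  _*ˢ_ : Series → Series → Series
  (f *ˢ g) n = ∑ n (λ i → f i * g (n ∸ i))

  C : Carrier → Series
  C x zero    = x
  C x (suc _) = 0#

  0ˢ 1ˢ X : Series
  0ˢ _ = 0#
  1ˢ = C 1#
  X (suc zero) = 1#
  X _          = 0#

  C-*ˢ : ∀ a f n → (C a *ˢ f) n ≈ a * f n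
  C-*ˢ a f zero    = refl
  C-*ˢ a f (suc n) = begin
    (C a *ˢ f) (suc n)                           ≈⟨ ∑-suc n _ ⟩
    a * f (suc n) + ∑ n (λ i → 0# * f (n ∸ i))   ≈⟨ +-congˡ (∑-zero n _ (λ i → zeroˡ _)) ⟩
    a * f (suc n) + 0#                           ≈⟨ +-identityʳ _ ⟩
    a * f (suc n)                                ∎

  *ˢ-identityˡ : ∀ f → 1ˢ *ˢ f ≈ˢ f
  *ˢ-identityˡ f n = trans (C-*ˢ 1# f n) (*-identityˡ _)

  X-*ˢ-zero : ∀ f → (X *ˢ f) 0 ≈ 0#
  X-*ˢ-zero f = zeroˡ (f 0)

  X-*ˢ-suc : ∀ f n → (X *ˢ f) (suc n) ≈ f n
  X-*ˢ-suc f n = begin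
    (X *ˢ f) (suc n)                                ≈⟨ ∑-suc n _ ⟩
    0# * f (suc n) + ∑ n (λ i → X (suc i) * f (n ∸ i)) ≈⟨ +-cong (zeroˡ _) (∑-cong n (λ i → *-congʳ (X-suc i))) ⟩
    0# + (1ˢ *ˢ f) n                                ≈⟨ +-identityˡ _ ⟩
    (1ˢ *ˢ f) n                                     ≈⟨ *ˢ-identityˡ f n ⟩
    f n                                             ∎
    where
    X-suc : ∀ i → X (suc i) ≈ 1ˢ i
    X-suc zero    = refl
    X-suc (suc i) = refl

  *ˢ-cong : ∀ {f f′ g g′} → f ≈ˢ f′ → g ≈ˢ g′ → f *ˢ g ≈ˢ f′ *ˢ g′
  *ˢ-cong f≈f′ g≈g′ n = ∑-cong n (λ i → *-cong (f≈f′ i) (g≈g′ (n ∸ i)))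

  *ˢ-congʳ : ∀ {f f′} g → f ≈ˢ f′ → f *ˢ g ≈ˢ f′ *ˢ g
  *ˢ-congʳ g f≈f′ = *ˢ-cong {g = g} f≈f′ (λ _ → refl)

  *ˢ-comm : ∀ f g → f *ˢ g ≈ˢ g *ˢ f
  *ˢ-comm f g n = trans (∑-reverse n _) (∑-cong-≤ n (λ {i} i≤n →
    trans (*-comm _ _) (*-congʳ (reflexive (≡.cong g (ℕP.m∸[m∸n]≡n i≤n))))))

  *ˢ-assoc : ∀ f g h → (f *ˢ g) *ˢ h ≈ˢ f *ˢ (g *ˢ h)
  *ˢ-assoc f g h n = begin
    ∑ n (λ m → ∑ m (λ i → f i * g (m ∸ i)) * h (n ∸ m))
      ≈⟨ ∑-cong n (λ m → ∑-*ʳ m _ _) ⟩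
    ∑ n (λ m → ∑ m (λ i → (f i * g (m ∸ i)) * h (n ∸ m)))
      ≈⟨ ∑-triangle n (λ i m → (f i * g (m ∸ i)) * h (n ∸ m)) ⟩
    ∑ n (λ i → ∑ (n ∸ i) (λ j → (f i * g ((i +ℕ j) ∸ i)) * h (n ∸ (i +ℕ j))))
      ≈⟨ ∑-cong n (λ i → ∑-cong (n ∸ i) (λ j → trans (*-assoc _ _ _)
           (*-congˡ (*-cong (reflexive (≡.cong g (ℕP.m+n∸m≡n i j)))
                            (reflexive (≡.cong h (≡.sym (ℕP.∸-+-assoc n i j)))))))) ⟩
    ∑ n (λ i → ∑ (n ∸ i) (λ j → f i * (g j * h (n ∸ i ∸ j))))
      ≈⟨ ∑-cong n (λ i → ∑-*ˡ (n ∸ i) _ _) ⟨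
    ∑ n (λ i → f i * (g *ˢ h) (n ∸ i)) ∎

  *ˢ-distribˡ : ∀ f g h → f *ˢ (g +ˢ h) ≈ˢ f *ˢ g +ˢ f *ˢ h
  *ˢ-distribˡ f g h n = trans (∑-cong n (λ i → distribˡ _ _ _)) (∑-+ n _ _)

  *ˢ-distribʳ : ∀ f g h → (g +ˢ h) *ˢ f ≈ˢ g *ˢ f +ˢ h *ˢ f
  *ˢ-distribʳ f g h n = trans (∑-cong n (λ i → distribʳ _ _ _)) (∑-+ n _ _)

  *ˢ-identityʳ : ∀ f → f *ˢ 1ˢ ≈ˢ f
  *ˢ-identityʳ f n = trans (*ˢ-comm f 1ˢ n) (*ˢ-identityˡ f n)

  isCommutativeRing : IsCommutativeRing _≈ˢ_ _+ˢ_ _*ˢ_ -ˢ_ 0ˢ 1ˢ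
  isCommutativeRing = record
    { isRing = record
      { +-isAbelianGroup = record
        { isGroup = record
          { isMonoid = record
            { isSemigroup = record
              { isMagma = record
                { isEquivalence = record
                  { refl  = λ _ → refl
                  ; sym   = λ f≈g n → sym (f≈g n)
                  ; trans = λ f≈g g≈h n → trans (f≈g n) (g≈h n)
                  }
                ; ∙-cong = λ f≈f′ g≈g′ n → +-cong (f≈f′ n) (g≈g′ n)
                }
              ; assoc = λ f g h n → +-assoc (f n) (g n) (h n)
              }
            ; identity = (λ f n → +-identityˡ (f n)) , (λ f n → +-identityʳ (f n))
            }
          ; inverse = (λ f n → -‿inverseˡ (f n)) , (λ f n → -‿inverseʳ (f n))
          ; ⁻¹-cong = λ f≈g n → -‿cong (f≈g n)
          }
        ; comm = λ f g n → +-comm (f n) (g n)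
        }
      ; *-cong     = *ˢ-cong
      ; *-assoc    = *ˢ-assoc
      ; *-identity = *ˢ-identityˡ , *ˢ-identityʳ
      ; distrib    = *ˢ-distribˡ , *ˢ-distribʳ
      }
    ; *-comm = *ˢ-comm
    }

  commutativeRing : CommutativeRing c ℓ
  commutativeRing = record { isCommutativeRing = isCommutativeRing }

  C-cong : ∀ {x y} → x ≈ y → C x ≈ˢ C y
  C-cong x≈y zero    = x≈y
  C-cong x≈y (suc n) = refl

  C-* : ∀ x y → C (x * y) ≈ˢ C x *ˢ C y
  C-* x y zero    = refl
  C-* x y (suc n) = sym (trans (C-*ˢ x (C y) (suc n)) (zeroʳ x))

  open FiniteSums (CommutativeRing.commutativeSemiring commutativeRing) using () renaming (∑ to ∑ˢ)

  ∑ˢ-coeff : ∀ n (F : ℕ → Series) k → ∑ˢ n F k ≈ ∑ n (λ i → F i k)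
  ∑ˢ-coeff zero    F k = refl
  ∑ˢ-coeff (suc n) F k = +-congʳ (∑ˢ-coeff n F k)

module _ {c ℓ} (R : CommutativeRing c ℓ) where

  open CommutativeRing R
  open import Relation.Binary.Reasoning.Setoid setoid

  isCommutativeRing-transport : ∀ (_∙_ : Carrier → Carrier → Carrier) e →
    (∀ x y → x ∙ y ≈ x * y) → e ≈ 1# → IsCommutativeRing _≈_ _+_ _∙_ -_ 0# e
  isCommutativeRing-transport _∙_ e ∙≈* e≈1 = record
    { isRing = record
      { +-isAbelianGroup = +-isAbelianGroup
      ; *-cong     = λ {x} {x′} {y} {y′} x≈x′ y≈y′ → begin
          x ∙ y    ≈⟨ ∙≈* x y ⟩
          x * y    ≈⟨ *-cong x≈x′ y≈y′ ⟩
          x′ * y′  ≈⟨ ∙≈* x′ y′ ⟨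
          x′ ∙ y′  ∎
      ; *-assoc    = λ x y z → begin
          (x ∙ y) ∙ z  ≈⟨ trans (∙≈* _ z) (*-congʳ (∙≈* x y)) ⟩
          (x * y) * z  ≈⟨ *-assoc x y z ⟩
          x * (y * z)  ≈⟨ trans (∙≈* x _) (*-congˡ (∙≈* y z)) ⟨
          x ∙ (y ∙ z)  ∎
      ; *-identity = (λ x → trans (∙≈* e x) (trans (*-congʳ e≈1) (*-identityˡ x)))
                   , (λ x → trans (∙≈* x e) (trans (*-congˡ e≈1) (*-identityʳ x)))
      ; distrib    = (λ x y z → begin
                        x ∙ (y + z)      ≈⟨ ∙≈* x _ ⟩
                        x * (y + z)      ≈⟨ distribˡ x y z ⟩
                        x * y + x * z    ≈⟨ +-cong (∙≈* x y) (∙≈* x z) ⟨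
                        x ∙ y + x ∙ z    ∎)
                   , (λ x y z → begin
                        (y + z) ∙ x      ≈⟨ ∙≈* _ x ⟩
                        (y + z) * x      ≈⟨ distribʳ x y z ⟩
                        y * x + z * x    ≈⟨ +-cong (∙≈* y x) (∙≈* z x) ⟨
                        y ∙ x + z ∙ x    ∎)
      }
    ; *-comm = λ x y → trans (∙≈* x y) (trans (*-comm x y) (sym (∙≈* y x)))
    }

open import Defs

module ℤ⟦t⟧ = PowerSeries ℤP.+-*-commutativeRing
module ℤ⟦t⟧⟦z⟧ = PowerSeries ℤ⟦t⟧.commutativeRing
open FiniteSums (CommutativeRing.commutativeSemiring ℤP.+-*-commutativeRing)

sumTo≡∑ : ∀ n f → sumTo n f ≡ ∑ n f
sumTo≡∑ zero    f = ≡.refl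
sumTo≡∑ (suc n) f = ≡.cong (ℤ._+ f (suc n)) (sumTo≡∑ n f)

⊗-coeff : ∀ f g n k → (f ⊗ g) n k ≡ ∑ n (λ i → ∑ k (λ j → f i j ℤ.* g (n ∸ i) (k ∸ j)))
⊗-coeff f g n k = ≡.trans (sumTo≡∑ n _) (∑-cong n (λ i → sumTo≡∑ k _))

-- Defs.Series, read as ℤ⟦t⟧⟦z⟧ (coefficients of z first)
⊗≈*ˢ : ∀ f g → f ⊗ g ≈ₛ f ℤ⟦t⟧⟦z⟧.*ˢ g
⊗≈*ˢ f g n k = ≡.trans (⊗-coeff f g n k) (≡.sym (ℤ⟦t⟧.∑ˢ-coeff n (λ i → f i ℤ⟦t⟧.*ˢ g (n ∸ i)) k))

const≈CC : ∀ c → const c ≈ₛ ℤ⟦t⟧⟦z⟧.C (ℤ⟦t⟧.C c)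
const≈CC c zero    zero    = ≡.refl
const≈CC c zero    (suc k) = ≡.refl
const≈CC c (suc n) k       = ≡.refl

ℤ⟦z,t⟧ : CommutativeRing _ _
ℤ⟦z,t⟧ = record
  { isCommutativeRing = isCommutativeRing-transport ℤ⟦t⟧⟦z⟧.commutativeRing _⊗_ 𝟙 ⊗≈*ˢ (const≈CC 1ℤ) }

const-homomorphism : CommutativeRing.rawRing ℤP.+-*-commutativeRing
                       -Raw-AlmostCommutative⟶ fromCommutativeRing ℤ⟦z,t⟧
const-homomorphism = record
  { ⟦_⟧    = const
  ; +-homo = +-homo
  ; *-homo = *-homo
  ; -‿homo = -‿homo
  ; 0-homo = 0-homo
  ; 1-homo = λ _ _ → ≡.refl
  }
  where
  open CommutativeRing ℤ⟦z,t⟧ using (_≈_; _+_; _*_; -_; 0#; sym; trans)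
  +-homo : ∀ a b → const (a ℤ.+ b) ≈ const a + const b
  +-homo a b zero    zero    = ≡.refl
  +-homo a b zero    (suc k) = ≡.refl
  +-homo a b (suc n) k       = ≡.refl
  -‿homo : ∀ a → const (ℤ.- a) ≈ - const a
  -‿homo a zero    zero    = ≡.refl
  -‿homo a zero    (suc k) = ≡.refl
  -‿homo a (suc n) k       = ≡.refl
  0-homo : const 0ℤ ≈ 0#
  0-homo zero    zero    = ≡.refl
  0-homo zero    (suc k) = ≡.refl
  0-homo (suc n) k       = ≡.refl
  *-homo : ∀ a b → const (a ℤ.* b) ≈ const a * const b
  *-homo a b = trans (const≈CC (a ℤ.* b)) (trans (ℤ⟦t⟧⟦z⟧.C-cong (ℤ⟦t⟧.C-* a b))
    (trans (ℤ⟦t⟧⟦z⟧.C-* _ _) (trans (ℤ⟦t⟧⟦z⟧.*ˢ-cong (sym (const≈CC a)) (sym (const≈CC b)))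
    (sym (⊗≈*ˢ (const a) (const b))))))

const-≟ : ∀ a b → Maybe (const a ≈ₛ const b)
const-≟ a b with a ℤ.≟ b
... | yes ≡.refl = just (λ _ _ → ≡.refl)
... | no  _      = nothing

open import Algebra.Solver.Ring (CommutativeRing.rawRing ℤP.+-*-commutativeRing)
  (fromCommutativeRing ℤ⟦z,t⟧) const-homomorphism const-≟

Z≈X : Z ≈ₛ ℤ⟦t⟧⟦z⟧.X
Z≈X zero          k       = ≡.refl
Z≈X (suc zero)    zero    = ≡.refl
Z≈X (suc zero)    (suc k) = ≡.refl
Z≈X (suc (suc n)) k       = ≡.refl

T≈CX : T ≈ₛ ℤ⟦t⟧⟦z⟧.C ℤ⟦t⟧.X
T≈CX zero    zero          = ≡.refl
T≈CX zero    (suc zero)    = ≡.refl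
T≈CX zero    (suc (suc k)) = ≡.refl
T≈CX (suc n) k             = ≡.refl

Z⊗-zero : ∀ f k → (Z ⊗ f) 0 k ≡ 0ℤ
Z⊗-zero f k = ≡.trans (⊗≈*ˢ Z f 0 k)
  (≡.trans (ℤ⟦t⟧⟦z⟧.*ˢ-congʳ f Z≈X 0 k) (ℤ⟦t⟧⟦z⟧.X-*ˢ-zero f k))

Z⊗-suc : ∀ f n k → (Z ⊗ f) (suc n) k ≡ f n k
Z⊗-suc f n k = ≡.trans (⊗≈*ˢ Z f (suc n) k)
  (≡.trans (ℤ⟦t⟧⟦z⟧.*ˢ-congʳ f Z≈X (suc n) k) (ℤ⟦t⟧⟦z⟧.X-*ˢ-suc f n k))

T⊗-coeff : ∀ f n k → (T ⊗ f) n k ≡ (ℤ⟦t⟧.X ℤ⟦t⟧.*ˢ f n) k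
T⊗-coeff f n k = ≡.trans (⊗≈*ˢ T f n k)
  (≡.trans (ℤ⟦t⟧⟦z⟧.*ˢ-congʳ f T≈CX n k) (ℤ⟦t⟧⟦z⟧.C-*ˢ ℤ⟦t⟧.X f n k))

T⊗-zero : ∀ f n → (T ⊗ f) n 0 ≡ 0ℤ
T⊗-zero f n = ≡.trans (T⊗-coeff f n 0) (ℤ⟦t⟧.X-*ˢ-zero (f n))

T⊗-suc : ∀ f n k → (T ⊗ f) n (suc k) ≡ f n k
T⊗-suc f n k = ≡.trans (T⊗-coeff f n (suc k)) (ℤ⟦t⟧.X-*ˢ-suc (f n) k)

open CommutativeRing ℤ⟦z,t⟧ using (setoid; +-cong)
  renaming (refl to ≈-refl; sym to ≈-sym; trans to ≈-trans)
module ≈ₛ-Reasoning = SetoidReasoning setoid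

⊗-congˡ : ∀ f {g h} → g ≈ₛ h → f ⊗ g ≈ₛ f ⊗ h
⊗-congˡ f = CommutativeRing.*-congˡ ℤ⟦z,t⟧ {f}

⊗-congʳ : ∀ f {g h} → g ≈ₛ h → g ⊗ f ≈ₛ h ⊗ f
⊗-congʳ f = CommutativeRing.*-congʳ ℤ⟦z,t⟧ {f}

⊖-congʳ : ∀ f {g h} → g ≈ₛ h → g ⊖ f ≈ₛ h ⊖ f
⊖-congʳ f g≈h = +-cong g≈h (≈-refl {CommutativeRing.-_ ℤ⟦z,t⟧ f})

⊖-congˡ : ∀ f {g h} → g ≈ₛ h → f ⊖ g ≈ₛ f ⊖ h
⊖-congˡ f g≈h = +-cong (≈-refl {f}) (CommutativeRing.-‿cong ℤ⟦z,t⟧ g≈h)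

≈⇒⊖≈0 : ∀ {f g} → f ≈ₛ g → f ⊖ g ≈ₛ const 0ℤ
≈⇒⊖≈0 {f} {g} f≈g = begin
  f ⊖ g  ≈⟨ +-cong f≈g ≈-refl ⟩
  g ⊖ g  ≈⟨ solve 1 (λ g → g :- g := con 0ℤ) ≈-refl g ⟩
  const 0ℤ ∎
  where open ≈ₛ-Reasoning

⊖≈0⇒≈ : ∀ {f g} → f ⊖ g ≈ₛ const 0ℤ → f ≈ₛ g
⊖≈0⇒≈ {f} {g} f-g≈0 = begin
  f                ≈⟨ solve 2 (λ f g → f := (f :- g) :+ g) ≈-refl f g ⟩
  (f ⊖ g) ⊕ g      ≈⟨ +-cong f-g≈0 ≈-refl ⟩
  const 0ℤ ⊕ g     ≈⟨ solve 1 (λ g → con 0ℤ :+ g := g) ≈-refl g ⟩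
  g                ∎
  where open ≈ₛ-Reasoning

geometric-series : ∀ {P} → P ≈ₛ 𝟙 ⊕ Z ⊗ P → (𝟙 ⊖ Z) ⊗ P ≈ₛ 𝟙
geometric-series {P} P-eq = begin
  (𝟙 ⊖ Z) ⊗ P         ≈⟨ solve 2 (λ z p → (con 1ℤ :- z) :* p := p :- z :* p) ≈-refl Z P ⟩
  P ⊖ Z ⊗ P           ≈⟨ +-cong P-eq ≈-refl ⟩
  (𝟙 ⊕ Z ⊗ P) ⊖ Z ⊗ P ≈⟨ solve 2 (λ z p → (con 1ℤ :+ z :* p) :- z :* p := con 1ℤ) ≈-refl Z P ⟩
  𝟙                   ∎
  where open ≈ₛ-Reasoning

geom-eq : geom ≈ₛ 𝟙 ⊕ Z ⊗ geom
geom-eq zero    zero    = ≡.sym (≡.cong (λ x → 1ℤ ℤ.+ x) (Z⊗-zero geom 0))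
geom-eq zero    (suc k) = ≡.sym (≡.cong (λ x → 0ℤ ℤ.+ x) (Z⊗-zero geom (suc k)))
geom-eq (suc n) zero    = ≡.sym (≡.cong (λ x → 0ℤ ℤ.+ x) (Z⊗-suc geom n 0))
geom-eq (suc n) (suc k) = ≡.sym (≡.cong (λ x → 0ℤ ℤ.+ x) (Z⊗-suc geom n (suc k)))

quadratic-relation : ∀ G B K →
  G ≈ₛ 𝟙 ⊕ Z ⊗ (G ⊗ B) → B ≈ₛ G ⊕ (T ⊖ 𝟙) ⊗ K → (𝟙 ⊖ Z) ⊗ K ≈ₛ Z ⊗ (B ⊖ 𝟙) →
  (𝟙 ⊖ Z) ⊗ (bSeries ⊗ G ⊖ Z ⊗ (G ⊗ G)) ≈ₛ 𝟙 ⊖ T ⊗ Z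
-- the difference of the two sides is a combination of the hypotheses, each written as lhs − rhs
quadratic-relation G B K G-eq B-eq K-eq = ⊖≈0⇒≈ (begin
  (𝟙 ⊖ Z) ⊗ (bSeries ⊗ G ⊖ Z ⊗ (G ⊗ G)) ⊖ (𝟙 ⊖ T ⊗ Z)
    ≈⟨ solve 5 (λ g b k z t →
         (con 1ℤ :- z) :* (((con 1ℤ :+ z) :- t :* z) :* g :- z :* (g :* g)) :- (con 1ℤ :- t :* z)
         := (con 1ℤ :- t :* z) :* (g :- (con 1ℤ :+ z :* (g :* b)))
            :+ (t :- con 1ℤ) :* z :* g :* ((con 1ℤ :- z) :* k :- z :* (b :- con 1ℤ))
            :+ (con 1ℤ :- z) :* z :* g :* (b :- (g :+ (t :- con 1ℤ) :* k)))
       ≈-refl G B K Z T ⟩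
  (𝟙 ⊖ T ⊗ Z) ⊗ (G ⊖ (𝟙 ⊕ Z ⊗ (G ⊗ B)))
    ⊕ (T ⊖ 𝟙) ⊗ Z ⊗ G ⊗ ((𝟙 ⊖ Z) ⊗ K ⊖ Z ⊗ (B ⊖ 𝟙))
    ⊕ (𝟙 ⊖ Z) ⊗ Z ⊗ G ⊗ (B ⊖ (G ⊕ (T ⊖ 𝟙) ⊗ K))
    ≈⟨ +-cong (+-cong (⊗-congˡ (𝟙 ⊖ T ⊗ Z) (≈⇒⊖≈0 G-eq)) (⊗-congˡ ((T ⊖ 𝟙) ⊗ Z ⊗ G) (≈⇒⊖≈0 K-eq)))
              (⊗-congˡ ((𝟙 ⊖ Z) ⊗ Z ⊗ G) (≈⇒⊖≈0 B-eq)) ⟩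
  (𝟙 ⊖ T ⊗ Z) ⊗ const 0ℤ ⊕ (T ⊖ 𝟙) ⊗ Z ⊗ G ⊗ const 0ℤ ⊕ (𝟙 ⊖ Z) ⊗ Z ⊗ G ⊗ const 0ℤ
    ≈⟨ solve 3 (λ g z t →
         (con 1ℤ :- t :* z) :* con 0ℤ :+ (t :- con 1ℤ) :* z :* g :* con 0ℤ :+ (con 1ℤ :- z) :* z :* g :* con 0ℤ
         := con 0ℤ) ≈-refl G Z T ⟩
  const 0ℤ ∎)
  where open ≈ₛ-Reasoning

square-root-of-discr : ∀ G → (𝟙 ⊖ Z) ⊗ (bSeries ⊗ G ⊖ Z ⊗ (G ⊗ G)) ≈ₛ 𝟙 ⊖ T ⊗ Z →
  (bSeries ⊖ const (+ 2) ⊗ Z ⊗ G) ⊗ (bSeries ⊖ const (+ 2) ⊗ Z ⊗ G) ≈ₛ discr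
square-root-of-discr G relation = begin
  (bSeries ⊖ const (+ 2) ⊗ Z ⊗ G) ⊗ (bSeries ⊖ const (+ 2) ⊗ Z ⊗ G)
    ≈⟨ solve 3 (λ b z g → (b :- con (+ 2) :* z :* g) :* (b :- con (+ 2) :* z :* g)
                        := b :* b :- con (+ 4) :* z :* (b :* g :- z :* (g :* g))) ≈-refl bSeries Z G ⟩
  bSeries ⊗ bSeries ⊖ const (+ 4) ⊗ Z ⊗ Q
    ≈⟨ ⊖-congˡ (bSeries ⊗ bSeries) (⊗-congˡ (const (+ 4) ⊗ Z) Q≈) ⟩
  bSeries ⊗ bSeries ⊖ const (+ 4) ⊗ Z ⊗ ((𝟙 ⊖ T ⊗ Z) ⊗ geom)
    ≈⟨ solve 4 (λ b z t q → b :* b :- con (+ 4) :* z :* ((con 1ℤ :- t :* z) :* q)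
                          := b :* b :- con (+ 4) :* z :* (con 1ℤ :- t :* z) :* q) ≈-refl bSeries Z T geom ⟩
  discr ∎
  where
  open ≈ₛ-Reasoning
  Q : Series
  Q = bSeries ⊗ G ⊖ Z ⊗ (G ⊗ G)
  Q≈ : Q ≈ₛ (𝟙 ⊖ T ⊗ Z) ⊗ geom
  Q≈ = begin
    Q                        ≈⟨ solve 1 (λ q → q := con 1ℤ :* q) ≈-refl Q ⟩
    𝟙 ⊗ Q                    ≈⟨ ⊗-congʳ Q (geometric-series geom-eq) ⟨
    ((𝟙 ⊖ Z) ⊗ geom) ⊗ Q     ≈⟨ solve 3 (λ z q x → ((con 1ℤ :- z) :* q) :* x := ((con 1ℤ :- z) :* x) :* q) ≈-refl Z geom Q ⟩
    ((𝟙 ⊖ Z) ⊗ Q) ⊗ geom     ≈⟨ ⊗-congʳ geom relation ⟩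
    (𝟙 ⊖ T ⊗ Z) ⊗ geom       ∎

data Tree : Set where
  leaf : Tree
  node : Tree → Tree → Tree

size : Tree → ℕ
size leaf       = 0
size (node a b) = suc (size a +ℕ size b)

node-injective : ∀ {a a′ b b′} → node a b ≡ node a′ b′ → a ≡ a′ × b ≡ b′
node-injective ≡.refl = ≡.refl , ≡.refl

-- node a b is the path U a D b, split at its first return to the axis
word : Tree → List Step
word leaf       = []
word (node a b) = U ∷ word a ++ D ∷ word b

length-word : ∀ t → length (word t) ≡ size t +ℕ size t
length-word leaf       = ≡.refl
length-word (node a b) = ≡.cong suc (begin
  length (word a ++ D ∷ word b)                ≡⟨ LP.length-++ (word a) ⟩
  length (word a) +ℕ suc (length (word b))     ≡⟨ ≡.cong₂ (λ x y → x +ℕ suc y) (length-word a) (length-word b) ⟩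
  (size a +ℕ size a) +ℕ suc (size b +ℕ size b) ≡⟨ rearrange (size a) (size b) ⟩
  (size a +ℕ size b) +ℕ suc (size a +ℕ size b) ∎)
  where
  open ≡.≡-Reasoning
  rearrange : ∀ x y → (x +ℕ x) +ℕ suc (y +ℕ y) ≡ (x +ℕ y) +ℕ suc (x +ℕ y)
  rearrange = solve-∀

dyckFrom-U : ∀ h w → dyckFrom h (U ∷ w) ≡ dyckFrom (suc h) w
dyckFrom-U zero    w = ≡.refl
dyckFrom-U (suc h) w = ≡.refl

dyckFrom-word : ∀ t h s → dyckFrom h (word t ++ s) ≡ dyckFrom h s
dyckFrom-word leaf       h s = ≡.refl
dyckFrom-word (node a b) h s = begin
  dyckFrom h (U ∷ (word a ++ D ∷ word b) ++ s)  ≡⟨ dyckFrom-U h _ ⟩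
  dyckFrom (suc h) ((word a ++ D ∷ word b) ++ s) ≡⟨ ≡.cong (dyckFrom (suc h)) (LP.++-assoc (word a) _ s) ⟩
  dyckFrom (suc h) (word a ++ D ∷ word b ++ s)   ≡⟨ dyckFrom-word a (suc h) _ ⟩
  dyckFrom h (word b ++ s)                       ≡⟨ dyckFrom-word b h s ⟩
  dyckFrom h s                                   ∎
  where open ≡.≡-Reasoning

isDyck-word : ∀ t → isDyck (word t) ≡ true
isDyck-word t = ≡.trans (≡.cong (dyckFrom 0) (≡.sym (LP.++-identityʳ (word t)))) (dyckFrom-word t 0 [])

-- word t₀ D word t₁ D ⋯ D word tₕ : a path from height h down to the axis
spine : ∀ {h} → Tree → Vec Tree h → List Step
spine t []        = word t
spine t (t′ ∷ ts) = word t ++ D ∷ spine t′ ts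

spine-node : ∀ {h} a b (ts : Vec Tree h) → spine (node a b) ts ≡ U ∷ word a ++ D ∷ spine b ts
spine-node a b []       = ≡.refl
spine-node a b (c ∷ cs) = ≡.cong (U ∷_) (LP.++-assoc (word a) (D ∷ word b) _)

dyckFrom⇒spine : ∀ h w → dyckFrom h w ≡ true → Σ Tree λ t → Σ (Vec Tree h) λ ts → w ≡ spine t ts
dyckFrom⇒spine zero    []      _ = leaf , [] , ≡.refl
dyckFrom⇒spine (suc h) (D ∷ w) p with dyckFrom⇒spine h w p
... | t , ts , w≡ = leaf , t ∷ ts , ≡.cong (D ∷_) w≡
dyckFrom⇒spine h       (U ∷ w) p with dyckFrom⇒spine (suc h) w (≡.trans (≡.sym (dyckFrom-U h w)) p)
... | t , t′ ∷ ts , w≡ = node t t′ , ts , ≡.trans (≡.cong (U ∷_) w≡) (≡.sym (spine-node t t′ ts))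

isDyck⇒word : ∀ w → isDyck w ≡ true → Σ Tree λ t → word t ≡ w
isDyck⇒word w p with dyckFrom⇒spine 0 w p
... | t , [] , w≡ = t , ≡.sym w≡

word-++-injective : ∀ t t′ s s′ → word t ++ D ∷ s ≡ word t′ ++ D ∷ s′ → t ≡ t′ × s ≡ s′
word-++-injective leaf       leaf         s s′ eq = ≡.refl , LP.∷-injectiveʳ eq
word-++-injective (node a b) (node a′ b′) s s′ eq
  with word-++-injective a a′ (word b ++ D ∷ s) (word b′ ++ D ∷ s′)
         (≡.trans (≡.sym (LP.++-assoc (word a) _ _)) (≡.trans (LP.∷-injectiveʳ eq) (LP.++-assoc (word a′) _ _)))
... | ≡.refl , eq′ with word-++-injective b b′ s s′ eq′
... | ≡.refl , s≡s′ = ≡.refl , s≡s′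

word-injective : ∀ {t t′} → word t ≡ word t′ → t ≡ t′
word-injective {t} {t′} eq = proj₁ (word-++-injective t t′ [] [] (≡.cong (_++ D ∷ []) eq))

isLeaf : Tree → Bool
isLeaf leaf       = true
isLeaf (node _ _) = false

-- the path has no valley
isPyramid : Tree → Bool
isPyramid leaf       = true
isPyramid (node a b) = isLeaf b ∧ isPyramid a

firstValleyOnGround : Tree → Bool
firstValleyOnGround leaf       = false
firstValleyOnGround (node a b) = not (isLeaf b) ∧ isPyramid a

-- sp′ computed on the tree: the valley between the two factors of node a b is on the
-- ground, so it pairs with the first valley of b exactly when that one is on the ground too
sp sp⁺ : Tree → ℕ
sp leaf       = 0
sp (node a b) = sp a +ℕ sp⁺ b
sp⁺ b = if firstValleyOnGround b then suc (sp b) else sp b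

-- afterReturn b: the valleys that the factor D b contributes to node a b, on the ground or above
valleys afterReturn : Tree → List ℕ
valleys leaf       = []
valleys (node a b) = map suc (valleys a) ++ afterReturn b
afterReturn leaf         = []
afterReturn b@(node _ _) = 0 ∷ valleys b

data NoLeadingUp : List Step → Set where
  nil  : NoLeadingUp []
  down : ∀ s → NoLeadingUp (D ∷ s)

map-+-suc : ∀ h xs → map (suc h +ℕ_) xs ≡ map (h +ℕ_) (map suc xs)
map-+-suc h xs = ≡.trans (LP.map-cong (λ x → ≡.sym (ℕP.+-suc h x)) xs) (LP.map-∘ xs)

valleyHeightsFrom-word : ∀ t h {s} → NoLeadingUp s →
  valleyHeightsFrom h (word t ++ s) ≡ map (h +ℕ_) (valleys t) ++ valleyHeightsFrom h s
valleyHeightsFrom-return : ∀ b h {s} → NoLeadingUp s →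
  valleyHeightsFrom (suc h) (D ∷ word b ++ s) ≡ map (h +ℕ_) (afterReturn b) ++ valleyHeightsFrom h s

valleyHeightsFrom-word leaf       h     s↓ = ≡.refl
valleyHeightsFrom-word (node a b) h {s} s↓ = begin
  valleyHeightsFrom (suc h) ((word a ++ D ∷ word b) ++ s)
    ≡⟨ ≡.cong (valleyHeightsFrom (suc h)) (LP.++-assoc (word a) (D ∷ word b) s) ⟩
  valleyHeightsFrom (suc h) (word a ++ D ∷ word b ++ s)
    ≡⟨ valleyHeightsFrom-word a (suc h) (down _) ⟩
  map (suc h +ℕ_) (valleys a) ++ valleyHeightsFrom (suc h) (D ∷ word b ++ s)
    ≡⟨ ≡.cong₂ _++_ (map-+-suc h (valleys a)) (valleyHeightsFrom-return b h s↓) ⟩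
  map (h +ℕ_) (map suc (valleys a)) ++ map (h +ℕ_) (afterReturn b) ++ valleyHeightsFrom h s
    ≡⟨ LP.++-assoc (map (h +ℕ_) (map suc (valleys a))) _ _ ⟨
  (map (h +ℕ_) (map suc (valleys a)) ++ map (h +ℕ_) (afterReturn b)) ++ valleyHeightsFrom h s
    ≡⟨ ≡.cong (_++ valleyHeightsFrom h s) (LP.map-++ (h +ℕ_) (map suc (valleys a)) (afterReturn b)) ⟨
  map (h +ℕ_) (valleys (node a b)) ++ valleyHeightsFrom h s ∎
  where open ≡.≡-Reasoning

valleyHeightsFrom-return leaf         h nil      = ≡.refl
valleyHeightsFrom-return leaf         h (down s) = ≡.refl
valleyHeightsFrom-return b@(node _ _) h s↓       =
  ≡.cong₂ _∷_ (≡.sym (ℕP.+-identityʳ h)) (valleyHeightsFrom-word b h s↓)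

valleyHeights-word : ∀ t → valleyHeights (word t) ≡ valleys t
valleyHeights-word t = begin
  valleyHeightsFrom 0 (word t)       ≡⟨ ≡.cong (valleyHeightsFrom 0) (LP.++-identityʳ (word t)) ⟨
  valleyHeightsFrom 0 (word t ++ []) ≡⟨ valleyHeightsFrom-word t 0 nil ⟩
  map (0 +ℕ_) (valleys t) ++ []      ≡⟨ LP.++-identityʳ _ ⟩
  map (λ x → x) (valleys t)          ≡⟨ LP.map-id (valleys t) ⟩
  valleys t                          ∎
  where open ≡.≡-Reasoning

null-valleys : ∀ t → null (valleys t) ≡ isPyramid t
null-valleys leaf              = ≡.refl
null-valleys (node a leaf)     = ≡.trans (null-map-suc (valleys a)) (null-valleys a)
  where
  null-map-suc : ∀ xs → null (map suc xs ++ []) ≡ null xs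
  null-map-suc []      = ≡.refl
  null-map-suc (_ ∷ _) = ≡.refl
null-valleys (node a (node _ _)) with valleys a
... | []    = ≡.refl
... | _ ∷ _ = ≡.refl

equalAdjacent-map-suc : ∀ xs → equalAdjacent (map suc xs) ≡ equalAdjacent xs
equalAdjacent-map-suc []          = ≡.refl
equalAdjacent-map-suc (x ∷ [])    = ≡.refl
equalAdjacent-map-suc (x ∷ y ∷ r) = ≡.cong ((if x ≡ᵇ y then 1 else 0) +ℕ_) (equalAdjacent-map-suc (y ∷ r))

-- the last entry of map suc xs is never 0
equalAdjacent-map-suc-++ : ∀ xs ys →
  equalAdjacent (map suc xs ++ 0 ∷ ys) ≡ equalAdjacent xs +ℕ equalAdjacent (0 ∷ ys)
equalAdjacent-map-suc-++ []          ys = ≡.refl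
equalAdjacent-map-suc-++ (x ∷ [])    ys = ≡.refl
equalAdjacent-map-suc-++ (x ∷ y ∷ r) ys =
  ≡.trans (≡.cong ((if x ≡ᵇ y then 1 else 0) +ℕ_) (equalAdjacent-map-suc-++ (y ∷ r) ys))
          (≡.sym (ℕP.+-assoc (if x ≡ᵇ y then 1 else 0) _ _))

equalAdjacent-ground : ∀ b → equalAdjacent (0 ∷ valleys b)
  ≡ (if firstValleyOnGround b then suc (equalAdjacent (valleys b)) else equalAdjacent (valleys b))
equalAdjacent-ground leaf = ≡.refl
equalAdjacent-ground (node b₁ leaf) with valleys b₁
... | []    = ≡.refl
... | _ ∷ _ = ≡.refl
equalAdjacent-ground (node b₁ (node _ _)) with valleys b₁ | isPyramid b₁ | null-valleys b₁
... | []    | .true  | ≡.refl = ≡.refl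
... | _ ∷ _ | .false | ≡.refl = ≡.refl

equalAdjacent-valleys : ∀ t → equalAdjacent (valleys t) ≡ sp t
equalAdjacent-valleys leaf = ≡.refl
equalAdjacent-valleys (node a leaf) = begin
  equalAdjacent (map suc (valleys a) ++ []) ≡⟨ ≡.cong equalAdjacent (LP.++-identityʳ (map suc (valleys a))) ⟩
  equalAdjacent (map suc (valleys a))       ≡⟨ equalAdjacent-map-suc (valleys a) ⟩
  equalAdjacent (valleys a)                 ≡⟨ equalAdjacent-valleys a ⟩
  sp a                                      ≡⟨ ℕP.+-identityʳ (sp a) ⟨
  sp a +ℕ 0                                 ∎
  where open ≡.≡-Reasoning
equalAdjacent-valleys (node a b@(node _ _)) = begin
  equalAdjacent (map suc (valleys a) ++ 0 ∷ valleys b)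
    ≡⟨ equalAdjacent-map-suc-++ (valleys a) (valleys b) ⟩
  equalAdjacent (valleys a) +ℕ equalAdjacent (0 ∷ valleys b)
    ≡⟨ ≡.cong₂ _+ℕ_ (equalAdjacent-valleys a) (equalAdjacent-ground b) ⟩
  sp a +ℕ (if firstValleyOnGround b then suc (equalAdjacent (valleys b)) else equalAdjacent (valleys b))
    ≡⟨ ≡.cong (λ n → sp a +ℕ (if firstValleyOnGround b then suc n else n)) (equalAdjacent-valleys b) ⟩
  sp (node a b) ∎
  where open ≡.≡-Reasoning

sp′-word : ∀ t → sp′ (word t) ≡ sp t
sp′-word t = ≡.trans (≡.cong equalAdjacent (valleyHeights-word t)) (equalAdjacent-valleys t)

Unique-concatMap⁺ : ∀ {A B : Set} {f : A → List B} {xs} → Unique xs → (∀ x → Unique (f x)) →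
                    (∀ {x y} → x ≢ y → Disjoint (f x) (f y)) → Unique (concatMap f xs)
Unique-concatMap⁺ xs! f! disjoint =
  UniqueP.concat⁺ (AllP.map⁺ (All.universal f! _)) (AllPairsP.map⁺ (AllPairs.map disjoint xs!))

same-members⇒↭ : ∀ {A : Set} {xs ys : List A} → Unique xs → Unique ys → (∀ {x} → x ∈ xs ⇔ x ∈ ys) → xs ↭ ys
same-members⇒↭ xs! ys! same = ∼bag⇒↭ (unique∧set⇒bag xs! ys! same)

-- all trees of size n, provided the fuel f is at least n
treesOfSize : (f n : ℕ) → List Tree
treesOfSize _       zero    = leaf ∷ []
treesOfSize zero    (suc n) = []
treesOfSize (suc f) (suc n) =
  concatMap (λ i → cartesianProductWith node (treesOfSize f i) (treesOfSize f (n ∸ i))) (upTo (suc n))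

trees : ℕ → List Tree
trees n = treesOfSize n n

∈-treesOfSize⁻ : ∀ f n {t} → t ∈ treesOfSize f n → size t ≡ n
∈-treesOfSize⁻ f       zero    (here ≡.refl) = ≡.refl
∈-treesOfSize⁻ (suc f) (suc n) t∈
  with i , i∈ , t∈i ← find (∈-concatMap⁻ (λ i → cartesianProductWith node (treesOfSize f i) (treesOfSize f (n ∸ i)))
                                         {xs = upTo (suc n)} t∈)
  with a , b , a∈ , b∈ , ≡.refl ← ∈-cartesianProductWith⁻ node (treesOfSize f i) (treesOfSize f (n ∸ i)) t∈i
  = ≡.cong suc (≡.trans (≡.cong₂ _+ℕ_ (∈-treesOfSize⁻ f i a∈) (∈-treesOfSize⁻ f (n ∸ i) b∈))
                        (ℕP.m+[n∸m]≡n (ℕ.s≤s⁻¹ (∈-upTo⁻ {suc n} i∈))))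

∈-treesOfSize⁺ : ∀ f t → size t ≤ℕ f → t ∈ treesOfSize f (size t)
∈-treesOfSize⁺ f       leaf       _ = here ≡.refl
∈-treesOfSize⁺ (suc f) (node a b) (s≤s sa+sb≤f) =
  ∈-concatMap⁺ (λ i → cartesianProductWith node (treesOfSize f i) (treesOfSize f ((size a +ℕ size b) ∸ i)))
    (Any.map (λ { ≡.refl → node∈ }) (∈-upTo⁺ (s≤s (ℕP.m≤m+n (size a) (size b)))))
  where
  b∈ : b ∈ treesOfSize f ((size a +ℕ size b) ∸ size a)
  b∈ = ≡.subst (λ m → b ∈ treesOfSize f m) (≡.sym (ℕP.m+n∸m≡n (size a) (size b)))
         (∈-treesOfSize⁺ f b (ℕP.≤-trans (ℕP.m≤n+m (size b) (size a)) sa+sb≤f))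
  node∈ = ∈-cartesianProductWith⁺ node (∈-treesOfSize⁺ f a (ℕP.≤-trans (ℕP.m≤m+n (size a) (size b)) sa+sb≤f)) b∈

∈-treesOfSize : ∀ {f n t} → n ≤ℕ f → t ∈ treesOfSize f n ⇔ size t ≡ n
∈-treesOfSize {f} {n} {t} n≤f = mk⇔ (∈-treesOfSize⁻ f n)
  (λ { ≡.refl → ∈-treesOfSize⁺ f t n≤f })

treesOfSize-unique : ∀ f n → Unique (treesOfSize f n)
treesOfSize-unique f       zero    = [] ∷ []
treesOfSize-unique zero    (suc n) = []
treesOfSize-unique (suc f) (suc n) = Unique-concatMap⁺ (UniqueP.upTo⁺ (suc n))
  (λ i → UniqueP.cartesianProductWith⁺ node node-injective (treesOfSize-unique f i) (treesOfSize-unique f (n ∸ i)))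
  disjoint
  where
  disjoint : ∀ {i j} → i ≢ j → Disjoint (cartesianProductWith node (treesOfSize f i) (treesOfSize f (n ∸ i)))
                                         (cartesianProductWith node (treesOfSize f j) (treesOfSize f (n ∸ j)))
  disjoint {i} {j} i≢j (t∈i , t∈j)
    with a , _ , a∈ , _ , ≡.refl ← ∈-cartesianProductWith⁻ node (treesOfSize f i) _ t∈i
    with a′ , _ , a′∈ , _ , eq ← ∈-cartesianProductWith⁻ node (treesOfSize f j) _ t∈j
    = i≢j (≡.trans (≡.sym (∈-treesOfSize⁻ f i a∈))
            (≡.trans (≡.cong size (proj₁ (node-injective eq))) (∈-treesOfSize⁻ f j a′∈)))

treesOfSize-↭ : ∀ {f n} → n ≤ℕ f → treesOfSize f n ↭ trees n
treesOfSize-↭ {f} {n} n≤f = same-members⇒↭ (treesOfSize-unique f n) (treesOfSize-unique n n)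
  (λ {t} → mk⇔ (λ t∈ → Equivalence.from (∈-treesOfSize ℕP.≤-refl) (Equivalence.to (∈-treesOfSize n≤f) t∈))
                (λ t∈ → Equivalence.from (∈-treesOfSize n≤f) (Equivalence.to (∈-treesOfSize ℕP.≤-refl) t∈)))

∑ₗ-trees-suc : ∀ n (F : Tree → ℤ) →
  ∑ₗ (trees (suc n)) F ≡ ∑ n (λ i → ∑ₗ (trees i) (λ a → ∑ₗ (trees (n ∸ i)) (λ b → F (node a b))))
∑ₗ-trees-suc n F = begin
  ∑ₗ (concatMap pairs (upTo (suc n))) F
    ≡⟨ ∑ₗ-concatMap pairs (upTo (suc n)) F ⟩
  ∑ₗ (upTo (suc n)) (λ i → ∑ₗ (pairs i) F)
    ≡⟨ ∑ₗ-applyUpTo (λ i → i) n (λ i → ∑ₗ (pairs i) F) ⟩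
  ∑ n (λ i → ∑ₗ (pairs i) F)
    ≡⟨ ∑-cong-≤ n (λ {i} i≤n → ≡.trans (∑ₗ-cartesianProductWith node (treesOfSize n i) (treesOfSize n (n ∸ i)) F)
                                        (change-fuel i≤n)) ⟩
  ∑ n (λ i → ∑ₗ (trees i) (λ a → ∑ₗ (trees (n ∸ i)) (λ b → F (node a b)))) ∎
  where
  open ≡.≡-Reasoning
  pairs : ℕ → List Tree
  pairs i = cartesianProductWith node (treesOfSize n i) (treesOfSize n (n ∸ i))
  change-fuel : ∀ {i} → i ≤ℕ n →
    ∑ₗ (treesOfSize n i) (λ a → ∑ₗ (treesOfSize n (n ∸ i)) (λ b → F (node a b)))
    ≡ ∑ₗ (trees i) (λ a → ∑ₗ (trees (n ∸ i)) (λ b → F (node a b)))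
  change-fuel {i} i≤n = ≡.trans
    (∑ₗ-cong (treesOfSize n i) (λ a → ∑ₗ-↭ _ (treesOfSize-↭ (ℕP.m∸n≤m n i))))
    (∑ₗ-↭ _ (treesOfSize-↭ i≤n))

extend : List Step → List (List Step)
extend w = (U ∷ w) ∷ (D ∷ w) ∷ []

∈-words⁺ : ∀ w → w ∈ words (length w)
∈-words⁺ []      = here ≡.refl
∈-words⁺ (s ∷ w) = ∈-concatMap⁺ extend (Any.map (λ { ≡.refl → s∷w∈ s }) (∈-words⁺ w))
  where
  s∷w∈ : ∀ s → s ∷ w ∈ extend w
  s∷w∈ U = here ≡.refl
  s∷w∈ D = there (here ≡.refl)

∈-words⁻ : ∀ m {w} → w ∈ words m → length w ≡ m
∈-words⁻ zero    (here ≡.refl) = ≡.refl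
∈-words⁻ (suc m) w∈ with find (∈-concatMap⁻ extend {xs = words m} w∈)
... | v , v∈ , here ≡.refl         = ≡.cong suc (∈-words⁻ m v∈)
... | v , v∈ , there (here ≡.refl) = ≡.cong suc (∈-words⁻ m v∈)

words-unique : ∀ m → Unique (words m)
words-unique zero    = [] ∷ []
words-unique (suc m) = Unique-concatMap⁺ (words-unique m) (λ _ → ((λ ()) ∷ []) ∷ [] ∷ []) disjoint
  where
  disjoint : ∀ {v w} → v ≢ w → Disjoint (extend v) (extend w)
  disjoint v≢w (here ≡.refl         , here eq)         = v≢w (LP.∷-injectiveʳ eq)
  disjoint v≢w (there (here ≡.refl) , there (here eq)) = v≢w (LP.∷-injectiveʳ eq)
  disjoint v≢w (here ≡.refl         , there (here ()))
  disjoint v≢w (there (here ≡.refl) , here ())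

∈-dyckPaths : ∀ {n w} → w ∈ dyckPaths n ⇔ (isDyck w ≡ true × length w ≡ n +ℕ n)
∈-dyckPaths {n} {w} = mk⇔
  (λ w∈ → let w∈words , dyck = ∈-filter⁻ isDyck? {xs = words (n +ℕ n)} w∈
          in Equivalence.to T-≡ dyck , ∈-words⁻ (n +ℕ n) w∈words)
  (λ (dyck , len) → ∈-filter⁺ isDyck? (≡.subst (λ m → w ∈ words m) len (∈-words⁺ w)) (Equivalence.from T-≡ dyck))
  where
  isDyck? = λ w → T? (isDyck w)

double-injective : ∀ {m n} → m +ℕ m ≡ n +ℕ n → m ≡ n
double-injective {m} {n} eq = ℕP.*-cancelˡ-≡ m n 2 (≡.trans (twice m) (≡.trans eq (≡.sym (twice n))))
  where
  twice : ∀ x → 2 ℕ.* x ≡ x +ℕ x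
  twice x = ≡.cong (x +ℕ_) (ℕP.+-identityʳ x)

dyckPaths-↭ : ∀ n → dyckPaths n ↭ map word (trees n)
dyckPaths-↭ n = same-members⇒↭
  (UniqueP.filter⁺ (λ w → T? (isDyck w)) (words-unique (n +ℕ n)))
  (UniqueP.map⁺ word-injective (treesOfSize-unique n n))
  (mk⇔ to from)
  where
  to : ∀ {w} → w ∈ dyckPaths n → w ∈ map word (trees n)
  to {w} w∈ with dyck , len ← Equivalence.to (∈-dyckPaths {n}) w∈
            with t , ≡.refl ← isDyck⇒word w dyck
    = ∈-map⁺ word (Equivalence.from (∈-treesOfSize {n} {n} ℕP.≤-refl)
                    (double-injective (≡.trans (≡.sym (length-word t)) len)))
  from : ∀ {w} → w ∈ map word (trees n) → w ∈ dyckPaths n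
  from w∈ with t , t∈ , ≡.refl ← ∈-map⁻ word w∈
    = Equivalence.from (∈-dyckPaths {n}) (isDyck-word t , ≡.trans (length-word t) (≡.cong (λ m → m +ℕ m) size≡n))
    where size≡n = Equivalence.to (∈-treesOfSize {n} {n} ℕP.≤-refl) t∈

length-filter≡∑ₗ-δ : ∀ {A : Set} (f : A → ℕ) k xs →
  + length (filter (λ x → f x ℕ.≟ k) xs) ≡ ∑ₗ xs (λ x → δ (f x) k)
length-filter≡∑ₗ-δ f k []       = ≡.refl
length-filter≡∑ₗ-δ f k (x ∷ xs) with f x ℕ.≟ k
... | yes fx≡k = ≡.trans (≡.cong (λ ys → + length ys) (LP.filter-accept (λ y → f y ℕ.≟ k) fx≡k))
                         (≡.cong₂ ℤ._+_ (≡.sym (≡.trans (≡.cong (λ y → δ y k) fx≡k) (δ-diagonal k)))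
                                        (length-filter≡∑ₗ-δ f k xs))
... | no  fx≢k = ≡.trans (≡.cong (λ ys → + length ys) (LP.filter-reject (λ y → f y ℕ.≟ k) fx≢k))
                         (≡.trans (length-filter≡∑ₗ-δ f k xs)
                         (≡.trans (≡.sym (ℤP.+-identityˡ _)) (≡.cong₂ ℤ._+_ (≡.sym (δ-off-diagonal fx≢k)) ≡.refl)))

dyckGF≡∑ₗ-trees : ∀ n k → dyckGF n k ≡ ∑ₗ (trees n) (λ t → δ (sp t) k)
dyckGF≡∑ₗ-trees n k = begin
  + length (filter (λ w → sp′ w ℕ.≟ k) (dyckPaths n)) ≡⟨ length-filter≡∑ₗ-δ sp′ k (dyckPaths n) ⟩
  ∑ₗ (dyckPaths n) (λ w → δ (sp′ w) k)                ≡⟨ ∑ₗ-↭ _ (dyckPaths-↭ n) ⟩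
  ∑ₗ (map word (trees n)) (λ w → δ (sp′ w) k)         ≡⟨ ∑ₗ-map word (trees n) _ ⟩
  ∑ₗ (trees n) (λ t → δ (sp′ (word t)) k)             ≡⟨ ∑ₗ-cong (trees n) (λ t → ≡.cong (λ m → δ m k) (sp′-word t)) ⟩
  ∑ₗ (trees n) (λ t → δ (sp t) k)                     ∎
  where open ≡.≡-Reasoning

𝟙[_] : Bool → ℤ
𝟙[ true  ] = 1ℤ
𝟙[ false ] = 0ℤ

𝟙[∧] : ∀ x y → 𝟙[ x ∧ y ] ≡ 𝟙[ x ] ℤ.* 𝟙[ y ]
𝟙[∧] true  true  = ≡.refl
𝟙[∧] true  false = ≡.refl
𝟙[∧] false y     = ≡.refl

treeGF : (Tree → Bool) → (Tree → ℕ) → Series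
treeGF P s n k = ∑ₗ (trees n) (λ t → 𝟙[ P t ] ℤ.* δ (s t) k)

treeGF-constant : ∀ P s → s leaf ≡ 0 → ∀ k → treeGF P s 0 k ≡ const 𝟙[ P leaf ] 0 k
treeGF-constant P s s-leaf zero    rewrite s-leaf = ≡.trans (ℤP.+-identityʳ _) (ℤP.*-identityʳ 𝟙[ P leaf ])
treeGF-constant P s s-leaf (suc k) rewrite s-leaf = ≡.trans (ℤP.+-identityʳ _) (ℤP.*-zeroʳ 𝟙[ P leaf ])

treeGF-node : ∀ P s P₁ s₁ P₂ s₂ →
  (∀ a b → P (node a b) ≡ P₁ a ∧ P₂ b) → (∀ a b → s (node a b) ≡ s₁ a +ℕ s₂ b) → s leaf ≡ 0 →
  treeGF P s ≈ₛ const 𝟙[ P leaf ] ⊕ Z ⊗ (treeGF P₁ s₁ ⊗ treeGF P₂ s₂)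
treeGF-node P s P₁ s₁ P₂ s₂ P-node s-node s-leaf zero k = begin
  treeGF P s 0 k                                  ≡⟨ treeGF-constant P s s-leaf k ⟩
  const 𝟙[ P leaf ] 0 k                           ≡⟨ ℤP.+-identityʳ _ ⟨
  const 𝟙[ P leaf ] 0 k ℤ.+ 0ℤ                    ≡⟨ ≡.cong (λ x → const 𝟙[ P leaf ] 0 k ℤ.+ x) (Z⊗-zero (treeGF P₁ s₁ ⊗ treeGF P₂ s₂) k) ⟨
  const 𝟙[ P leaf ] 0 k ℤ.+ (Z ⊗ (treeGF P₁ s₁ ⊗ treeGF P₂ s₂)) 0 k ∎
  where open ≡.≡-Reasoning
treeGF-node P s P₁ s₁ P₂ s₂ P-node s-node s-leaf (suc n) k = begin
  ∑ₗ (trees (suc n)) (λ t → 𝟙[ P t ] ℤ.* δ (s t) k)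
    ≡⟨ ∑ₗ-trees-suc n _ ⟩
  ∑ n (λ i → ∑ₗ (trees i) (λ a → ∑ₗ (trees (n ∸ i)) (λ b → 𝟙[ P (node a b) ] ℤ.* δ (s (node a b)) k)))
    ≡⟨ ∑-cong n (λ i → ∑ₗ-cong (trees i) (λ a → ∑ₗ-cong (trees (n ∸ i)) (λ b →
         ≡.cong₂ ℤ._*_ (≡.trans (≡.cong 𝟙[_] (P-node a b)) (𝟙[∧] (P₁ a) (P₂ b))) (≡.cong (λ m → δ m k) (s-node a b))))) ⟩
  ∑ n (λ i → ∑ₗ (trees i) (λ a → ∑ₗ (trees (n ∸ i)) (λ b → (𝟙[ P₁ a ] ℤ.* 𝟙[ P₂ b ]) ℤ.* δ (s₁ a +ℕ s₂ b) k)))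
    ≡⟨ ∑-cong n (λ i → ∑ₗ-δ-convolution (trees i) (trees (n ∸ i)) (λ a → 𝟙[ P₁ a ]) s₁ (λ b → 𝟙[ P₂ b ]) s₂ k) ⟩
  ∑ n (λ i → ∑ k (λ c → treeGF P₁ s₁ i c ℤ.* treeGF P₂ s₂ (n ∸ i) (k ∸ c)))
    ≡⟨ ⊗-coeff (treeGF P₁ s₁) (treeGF P₂ s₂) n k ⟨
  (treeGF P₁ s₁ ⊗ treeGF P₂ s₂) n k
    ≡⟨ Z⊗-suc (treeGF P₁ s₁ ⊗ treeGF P₂ s₂) n k ⟨
  (Z ⊗ (treeGF P₁ s₁ ⊗ treeGF P₂ s₂)) (suc n) k
    ≡⟨ ℤP.+-identityˡ _ ⟨
  (const 𝟙[ P leaf ] ⊕ Z ⊗ (treeGF P₁ s₁ ⊗ treeGF P₂ s₂)) (suc n) k ∎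
  where open ≡.≡-Reasoning

treeGF-isLeaf : ∀ s → s leaf ≡ 0 → treeGF isLeaf s ≈ₛ 𝟙
treeGF-isLeaf s s-leaf zero    k = treeGF-constant isLeaf s s-leaf k
treeGF-isLeaf s s-leaf (suc n) k = ≡.trans (∑ₗ-trees-suc n _)
  (∑-zero n _ (λ i → ∑ₗ-zero (trees i) _ (λ a → ∑ₗ-zero (trees (n ∸ i)) _ (λ b → ≡.refl))))

treeGF-+ : ∀ P s P₁ s₁ P₂ s₂ →
  (∀ t k → 𝟙[ P t ] ℤ.* δ (s t) k ≡ 𝟙[ P₁ t ] ℤ.* δ (s₁ t) k ℤ.+ 𝟙[ P₂ t ] ℤ.* δ (s₂ t) k) →
  treeGF P s ≈ₛ treeGF P₁ s₁ ⊕ treeGF P₂ s₂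
treeGF-+ P s P₁ s₁ P₂ s₂ split n k = ≡.trans (∑ₗ-cong (trees n) (λ t → split t k)) (∑ₗ-+ (trees n) _ _)

treeGF-partition : ∀ (P Q : Tree → Bool) s → treeGF P s ≈ₛ treeGF (λ t → P t ∧ not (Q t)) s ⊕ treeGF (λ t → P t ∧ Q t) s
treeGF-partition P Q s = treeGF-+ P s (λ t → P t ∧ not (Q t)) s (λ t → P t ∧ Q t) s (λ t k → split (P t) (Q t) (δ (s t) k))
  where
  split : ∀ p q d → 𝟙[ p ] ℤ.* d ≡ 𝟙[ p ∧ not q ] ℤ.* d ℤ.+ 𝟙[ p ∧ q ] ℤ.* d
  split false q     d = ≡.refl
  split true  false d = ≡.sym (ℤP.+-identityʳ _)
  split true  true  d = ≡.sym (ℤP.+-identityˡ _)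

treeGF-suc : ∀ P (s : Tree → ℕ) → treeGF P (λ t → suc (s t)) ≈ₛ T ⊗ treeGF P s
treeGF-suc P s n zero    = ≡.trans (∑ₗ-zero (trees n) _ (λ t → ℤP.*-zeroʳ 𝟙[ P t ])) (≡.sym (T⊗-zero (treeGF P s) n))
treeGF-suc P s n (suc k) = ≡.sym (T⊗-suc (treeGF P s) n k)

treeGF-if-suc : ∀ (P Q : Tree → Bool) s → treeGF P (λ t → if Q t then suc (s t) else s t)
                          ≈ₛ treeGF (λ t → P t ∧ not (Q t)) s ⊕ T ⊗ treeGF (λ t → P t ∧ Q t) s
treeGF-if-suc P Q s = ≈-trans (treeGF-+ P (λ t → if Q t then suc (s t) else s t) (λ t → P t ∧ not (Q t)) s (λ t → P t ∧ Q t) (λ t → suc (s t))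
                                        (λ t k → split (P t) (Q t) (s t) (suc (s t)) k))
                              (+-cong (≈-refl {treeGF (λ t → P t ∧ not (Q t)) s}) (treeGF-suc (λ t → P t ∧ Q t) s))
  where
  split : ∀ p q m m′ k → 𝟙[ p ] ℤ.* δ (if q then m′ else m) k ≡ 𝟙[ p ∧ not q ] ℤ.* δ m k ℤ.+ 𝟙[ p ∧ q ] ℤ.* δ m′ k
  split false q     m m′ k = ≡.refl
  split true  false m m′ k = ≡.sym (ℤP.+-identityʳ _)
  split true  true  m m′ k = ≡.sym (ℤP.+-identityˡ _)

-- G counts all paths and K those whose first valley is on the ground; B is the series of sp⁺,
-- the contribution of the right factor of node a b; P counts the pyramids (a single one per size)
G B K P : Series
G = treeGF (λ _ → true) sp
B = treeGF (λ _ → true) sp⁺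
K = treeGF firstValleyOnGround sp
P = treeGF isPyramid sp

dyckGF≈G : dyckGF ≈ₛ G
dyckGF≈G n k = ≡.trans (dyckGF≡∑ₗ-trees n k) (∑ₗ-cong (trees n) (λ t → ≡.sym (ℤP.*-identityˡ _)))

G-eq : G ≈ₛ 𝟙 ⊕ Z ⊗ (G ⊗ B)
G-eq = treeGF-node (λ _ → true) sp (λ _ → true) sp (λ _ → true) sp⁺ (λ _ _ → ≡.refl) (λ _ _ → ≡.refl) ≡.refl

B-eq : B ≈ₛ G ⊕ (T ⊖ 𝟙) ⊗ K
B-eq = begin
  B                      ≈⟨ treeGF-if-suc (λ _ → true) firstValleyOnGround sp ⟩
  L ⊕ T ⊗ K              ≈⟨ solve 3 (λ l k t → l :+ t :* k := (l :+ k) :+ (t :- con 1ℤ) :* k) ≈-refl L K T ⟩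
  (L ⊕ K) ⊕ (T ⊖ 𝟙) ⊗ K  ≈⟨ +-cong (≈-sym (treeGF-partition (λ _ → true) firstValleyOnGround sp)) ≈-refl ⟩
  G ⊕ (T ⊖ 𝟙) ⊗ K        ∎
  where
  open ≈ₛ-Reasoning
  L = treeGF (λ t → not (firstValleyOnGround t)) sp

P-eq : (𝟙 ⊖ Z) ⊗ P ≈ₛ 𝟙
P-eq = geometric-series (begin
  P                                ≈⟨ treeGF-node isPyramid sp isPyramid sp isLeaf sp⁺
                                        (λ a b → ∧-comm (isLeaf b) (isPyramid a)) (λ _ _ → ≡.refl) ≡.refl ⟩
  𝟙 ⊕ Z ⊗ (P ⊗ treeGF isLeaf sp⁺)  ≈⟨ +-cong (≈-refl {𝟙}) (⊗-congˡ Z (⊗-congˡ P (treeGF-isLeaf sp⁺ ≡.refl))) ⟩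
  𝟙 ⊕ Z ⊗ (P ⊗ 𝟙)                  ≈⟨ solve 2 (λ z p → con 1ℤ :+ z :* (p :* con 1ℤ) := con 1ℤ :+ z :* p) ≈-refl Z P ⟩
  𝟙 ⊕ Z ⊗ P                        ∎)
  where open ≈ₛ-Reasoning

K-eq : (𝟙 ⊖ Z) ⊗ K ≈ₛ Z ⊗ (B ⊖ 𝟙)
K-eq = begin
  (𝟙 ⊖ Z) ⊗ K
    ≈⟨ ⊗-congˡ (𝟙 ⊖ Z) (treeGF-node firstValleyOnGround sp isPyramid sp (λ t → not (isLeaf t)) sp⁺
                          (λ a b → ∧-comm (not (isLeaf b)) (isPyramid a)) (λ _ _ → ≡.refl) ≡.refl) ⟩
  (𝟙 ⊖ Z) ⊗ (const 0ℤ ⊕ Z ⊗ (P ⊗ B₊))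
    ≈⟨ solve 4 (λ z p b o → (o :- z) :* (con 0ℤ :+ z :* (p :* b)) := z :* (((o :- z) :* p) :* b)) ≈-refl Z P B₊ 𝟙 ⟩
  Z ⊗ (((𝟙 ⊖ Z) ⊗ P) ⊗ B₊)
    ≈⟨ ⊗-congˡ Z (⊗-congʳ B₊ P-eq) ⟩
  Z ⊗ (𝟙 ⊗ B₊)
    ≈⟨ ⊗-congˡ Z (solve 2 (λ b e → con 1ℤ :* b := (b :+ e) :- e) ≈-refl B₊ 𝟙) ⟩
  Z ⊗ ((B₊ ⊕ 𝟙) ⊖ 𝟙)
    ≈⟨ ⊗-congˡ Z (⊖-congʳ 𝟙 B≈B₊+1) ⟨
  Z ⊗ (B ⊖ 𝟙) ∎
  where
  open ≈ₛ-Reasoning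
  B₊ = treeGF (λ t → not (isLeaf t)) sp⁺
  B≈B₊+1 : B ≈ₛ B₊ ⊕ 𝟙
  B≈B₊+1 = ≈-trans (treeGF-partition (λ _ → true) isLeaf sp⁺) (+-cong (≈-refl {B₊}) (treeGF-isLeaf sp⁺ ≡.refl))

theorem2p3 : Σ Series (λ S → (S ⊗ S ≈ₛ discr) × (S 0 0 ≡ + 1)
               × (const (+ 2) ⊗ Z ⊗ dyckGF ≈ₛ bSeries ⊖ S))
theorem2p3 = bSeries ⊖ const (+ 2) ⊗ Z ⊗ G
           , square-root-of-discr G (quadratic-relation G B K G-eq B-eq K-eq)
           , ≡.refl
           , (begin
               const (+ 2) ⊗ Z ⊗ dyckGF
                 ≈⟨ ⊗-congˡ (const (+ 2) ⊗ Z) dyckGF≈G ⟩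
               const (+ 2) ⊗ Z ⊗ G
                 ≈⟨ solve 3 (λ b c g → c :* g := b :- (b :- c :* g)) ≈-refl bSeries (const (+ 2) ⊗ Z) G ⟩
               bSeries ⊖ (bSeries ⊖ const (+ 2) ⊗ Z ⊗ G) ∎)
  where open ≈ₛ-Reasoning
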